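{- Let $\mathbf D=\langle D,+,',1\rangle$ be an orthogroupoid and let $R$ be the relation on $D$ given by $(a,b)\in R$ iff $a+b=b$. Then $\langle D,R,',1\rangle$ is an orthogonal relational system and $R$ is reflexive.
   Context: An orthogroupoid is an algebra $\mathbf D=\langle D,+,',1\rangle$ of type $(2,1,0)$, with $0:=1'$, satisfying: (a) $x''\approx x$; (b) $0+x\approx x$ and $x+1\approx 1$; (c) $x+x'\approx 1$; (d) for all $x,z$: if $x+z=z$ and $x'+z=z$ then $z=1$; (e) $(((z+y)'+(z+x))'+(z+y)')+z'\approx z'$; (f) $x+(x+y)\approx x+y$ and $y+(x+y)\approx x+y$. A relational system is a pair $\langle A,R\rangle$ with $A\neq\emptyset$ and $R\subseteq A^2$; $U_R(a,b)=\{c:(a,c)\in R,(b,c)\in R\}$. A relational system with 1 and involution is $\langle A,R,',1\rangle$ where $':A\to A$ satisfies $a''=a$ and $(a,b)\in R\Rightarrow(b',a')\in R$, and $1\in A$ satisfies $(x,1)\in R$ for all $x$; put $0=1'$. Elements $a,b$ are orthogonal ($a\perp b$) if $(a,b')\in R$. An element $w\in U_R(a,b)$ is a supremal element for $a,b$ if $(w,z)\in R$ for every $z\in U_R(a,b)$ with $z\neq w$. Such a system is orthogonal if (a) $U_R(x,x')=\{1\}$ for every $x$, and (b) whenever $x\perp y$ and $x\neq 0\neq y$, a supremal element for $x,y$ exists. -}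

module Defs where

open import Level using (Level; _⊔_; suc)
open import Data.Product using (Σ; _×_; _,_)
open import Relation.Binary.PropositionalEquality using (_≡_)
open import Relation.Nullary using (¬_)

record IsOrthogroupoid {a} (D : Set a) (_+_ : D → D → D) (_′ : D → D) (𝟏 : D) : Set a where
  𝟎 : D
  𝟎 = 𝟏 ′
  field
    invol   : ∀ x → (x ′) ′ ≡ x
    zero-l  : ∀ x → 𝟎 + x ≡ x
    one-r   : ∀ x → x + 𝟏 ≡ 𝟏
    compl   : ∀ x → x + (x ′) ≡ 𝟏
    quasi   : ∀ x z → x + z ≡ z → (x ′) + z ≡ z → z ≡ 𝟏
    axE     : ∀ x y z →
              ((((((z + y) ′) + (z + x)) ′) + ((z + y) ′)) + (z ′)) ≡ (z ′)
    absorbL : ∀ x y → x + (x + y) ≡ x + y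
    absorbR : ∀ x y → y + (x + y) ≡ x + y

module _ {a r} {A : Set a} (R : A → A → Set r) where

  U : A → A → A → Set r
  U x y c = R x c × R y c

  IsSupremal : A → A → A → Set (a ⊔ r)
  IsSupremal x y w = U x y w × (∀ z → U x y z → ¬ (z ≡ w) → R w z)

  Reflexive : Set (a ⊔ r)
  Reflexive = ∀ x → R x x

record IsRelSysWith1Inv {a r} {A : Set a} (R : A → A → Set r)
                        (_′ : A → A) (𝟏 : A) : Set (a ⊔ r) where
  field
    invol  : ∀ x → (x ′) ′ ≡ x
    antitone : ∀ x y → R x y → R (y ′) (x ′)
    top    : ∀ x → R x 𝟏

record IsOrthogonalRelSys {a r} {A : Set a} (R : A → A → Set r)
                          (_′ : A → A) (𝟏 : A) : Set (a ⊔ r) where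
  𝟎 : A
  𝟎 = 𝟏 ′
  _⊥_ : A → A → Set r
  x ⊥ y = R x (y ′)
  field
    relSys   : IsRelSysWith1Inv R _′ 𝟏
    U-compl  : ∀ x c → (U R x (x ′) c → c ≡ 𝟏) × (c ≡ 𝟏 → U R x (x ′) c)
    supremal : ∀ x y → x ⊥ y → ¬ (x ≡ 𝟎) → ¬ (y ≡ 𝟎) →
               Σ A (λ w → IsSupremal R x y w)

-- With x ≤ y meaning x + y = y, axiom (e) at x = 1 says that ′ is antitone, and axiom (e)
-- at the complements of x, y, z says that x + y lies below every common upper bound z of
-- an orthogonal pair x, y.  Hence x + y is a supremal element, and axiom (d) is exactly
-- the statement that 1 is the only upper bound of x and x′.
module Submission where

open import Defs
open import Data.Product using (_×_; _,_)
open import Relation.Binary.PropositionalEquality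
  using (_≡_; refl; sym; trans; cong; cong₂; module ≡-Reasoning)

module OrthogroupoidOrder {a} {D : Set a} {_+_ : D → D → D} {_′ : D → D} {𝟏 : D}
                          (O : IsOrthogroupoid D _+_ _′ 𝟏) where
  open IsOrthogroupoid O
  open ≡-Reasoning

  _≤_ : D → D → Set a
  x ≤ y = x + y ≡ y

  ≤-refl : ∀ x → x ≤ x
  ≤-refl x = begin
    x + x          ≡⟨ cong (x +_) (sym (zero-l x)) ⟩
    x + (𝟎 + x)    ≡⟨ absorbR 𝟎 x ⟩
    𝟎 + x          ≡⟨ zero-l x ⟩
    x              ∎

  ′-antitone : ∀ x y → x ≤ y → (y ′) ≤ (x ′)
  ′-antitone x y x≤y = begin
    (y ′) + (x ′)                                               ≡⟨ cong (_+ (x ′)) (sym (zero-l (y ′))) ⟩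
    (𝟎 + (y ′)) + (x ′)                                         ≡⟨ cong (λ t → ((t ′) + (y ′)) + (x ′)) (sym (one-r (y ′))) ⟩
    ((((y ′) + 𝟏) ′) + (y ′)) + (x ′)                           ≡⟨ cong (λ t → ((((y ′) + t) ′) + (y ′)) + (x ′)) (sym (one-r x)) ⟩
    ((((y ′) + (x + 𝟏)) ′) + (y ′)) + (x ′)                     ≡⟨ cong (λ t → ((((t ′) + (x + 𝟏)) ′) + (t ′)) + (x ′)) (sym x≤y) ⟩
    (((((x + y) ′) + (x + 𝟏)) ′) + ((x + y) ′)) + (x ′)         ≡⟨ axE 𝟏 y x ⟩
    x ′                                                         ∎

  +-least-upper-bound : ∀ x y z → x ≤ (y ′) → x ≤ z → y ≤ z → (x + y) ≤ z
  +-least-upper-bound x y z x≤y′ x≤z y≤z = begin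
    (x + y) + z                                   ≡⟨ cong₂ (λ s t → (s + t) + z) x≡v y≡w′ ⟩
    (v + (w ′)) + z                               ≡⟨ cong ((v + (w ′)) +_) (sym (invol z)) ⟩
    (v + (w ′)) + ((z ′) ′)                       ≡⟨ axE (x ′) (y ′) (z ′) ⟩
    (z ′) ′                                       ≡⟨ invol z ⟩
    z                                             ∎
    where
      w v : D
      w = (z ′) + (y ′)
      v = ((w ′) + ((z ′) + (x ′))) ′

      y≡w′ : y ≡ w ′
      y≡w′ = trans (sym (invol y)) (cong _′ (sym (′-antitone y z y≤z)))

      y≤x′ : y ≤ (x ′)
      y≤x′ = trans (cong (_+ (x ′)) (sym (invol y))) (′-antitone x (y ′) x≤y′)

      x≡v : x ≡ v
      x≡v = begin
        x                              ≡⟨ sym (invol x) ⟩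
        (x ′) ′                        ≡⟨ cong _′ (sym y≤x′) ⟩
        (y + (x ′)) ′                  ≡⟨ cong₂ (λ s t → (s + t) ′) y≡w′ (sym (′-antitone x z x≤z)) ⟩
        v                              ∎

  isOrthogonalRelSys : IsOrthogonalRelSys _≤_ _′ 𝟏
  isOrthogonalRelSys = record
    { relSys   = record { invol = invol ; antitone = ′-antitone ; top = one-r }
    ; U-compl  = λ x c → (λ { (x≤c , x′≤c) → quasi x c x≤c x′≤c })
                       , (λ { refl → one-r x , one-r (x ′) })
    ; supremal = λ x y x≤y′ _ _ →
        x + y , (absorbL x y , absorbR x y)
              , λ { z (x≤z , y≤z) _ → +-least-upper-bound x y z x≤y′ x≤z y≤z }
    }

theorem2p10 : ∀ {a} {D : Set a} {_+_ : D → D → D} {_′ : D → D} {𝟏 : D} →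
    IsOrthogroupoid D _+_ _′ 𝟏 →
    IsOrthogonalRelSys (λ x y → x + y ≡ y) _′ 𝟏 × Reflexive (λ x y → x + y ≡ y)
theorem2p10 O = isOrthogonalRelSys , ≤-refl
  where open OrthogroupoidOrder O
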